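{- Let $G=G[V_1,V_2]$ be a bipartite graph with bipartition $(V_1,V_2)$. If $\ell$ is a positive integer such that $|V_1|\ge|V_2|\ge\ell$ and $G$ is $a$-almost-complete for some $a$ with $0<a/\ell<0.5$, then $G$ contains a connected-matching on at least $2|V_2|-2a$ vertices.
   Context: A bipartite graph $G[V_1,V_2]$ is $a$-almost-complete if every $u\in V_1$ has degree at least $|V_2|-a$ and every $w\in V_2$ has degree at least $|V_1|-a$. A connected-matching is a matching (set of pairwise vertex-disjoint edges) all of whose edges lie in a single connected component of $G$. -}

module Defs where

open import Data.Nat using (ℕ; _+_; _*_; _∸_; _≤_)
open import Data.Bool using (Bool; true; false)
open import Data.Fin using (Fin)
open import Data.List using (List; []; _∷_; length; map; filter; allFin)
open import Data.List.Relation.Unary.All using (All)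
open import Data.List.Relation.Unary.Unique.Propositional using (Unique)
open import Data.Product using (_×_; _,_; proj₁; proj₂; Σ; ∃)
open import Data.Sum using (_⊎_; inj₁; inj₂)
open import Relation.Binary.PropositionalEquality using (_≡_)
open import Relation.Nullary.Decidable using (Dec)
import Data.Bool.Properties as BP

record BipGraph (n₁ n₂ : ℕ) : Set where
  field
    adj : Fin n₁ → Fin n₂ → Bool

open BipGraph public

deg₁ : ∀ {n₁ n₂} → BipGraph n₁ n₂ → Fin n₁ → ℕ
deg₁ G u = length (filter (λ w → BP._≟_ (adj G u w) true) (allFin _))

deg₂ : ∀ {n₁ n₂} → BipGraph n₁ n₂ → Fin n₂ → ℕ
deg₂ G w = length (filter (λ u → BP._≟_ (adj G u w) true) (allFin _))

AlmostComplete : ∀ {n₁ n₂} → ℕ → BipGraph n₁ n₂ → Set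
AlmostComplete {n₁} {n₂} a G =
  (∀ u → n₂ ∸ a ≤ deg₁ G u) × (∀ w → n₁ ∸ a ≤ deg₂ G w)

Vertex : ℕ → ℕ → Set
Vertex n₁ n₂ = Fin n₁ ⊎ Fin n₂

Adjacent : ∀ {n₁ n₂} → BipGraph n₁ n₂ → Vertex n₁ n₂ → Vertex n₁ n₂ → Set
Adjacent G (inj₁ u) (inj₂ w) = adj G u w ≡ true
Adjacent G (inj₂ w) (inj₁ u) = adj G u w ≡ true
Adjacent G _ _ = Data.Empty.⊥
  where import Data.Empty

data Connected {n₁ n₂} (G : BipGraph n₁ n₂) : Vertex n₁ n₂ → Vertex n₁ n₂ → Set where
  here : ∀ {x} → Connected G x x
  step : ∀ {x y z} → Adjacent G x y → Connected G y z → Connected G x z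

IsMatching : ∀ {n₁ n₂} → BipGraph n₁ n₂ → List (Fin n₁ × Fin n₂) → Set
IsMatching G M =
  All (λ e → adj G (proj₁ e) (proj₂ e) ≡ true) M
  × Unique (map proj₁ M) × Unique (map proj₂ M)

IsConnectedMatching : ∀ {n₁ n₂} → BipGraph n₁ n₂ → List (Fin n₁ × Fin n₂) → Set
IsConnectedMatching {n₁} {n₂} G M =
  IsMatching G M × Σ (Vertex n₁ n₂) (λ c → All (λ e → Connected G c (inj₁ (proj₁ e)) × Connected G c (inj₂ (proj₂ e))) M)

matchingVertices : ∀ {A : Set} → List A → ℕ
matchingVertices M = 2 * length M

-- Since 2a < |V₁|, two neighbourhoods of vertices of V₂ have more than |V₁| elements in
-- total and so meet: any two vertices of V₂ share a neighbour, and as every vertex of V₁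
-- has |V₂| − a > 0 neighbours, G is connected. Hence any matching is a connected-matching,
-- and one of size |V₂| − a is built greedily: while fewer than |V₂| − a ≤ |V₁| edges are
-- chosen some u ∈ V₁ is unmatched, and its |V₂| − a neighbours cannot all be matched.
module Submission where

open import Defs
open import Data.Nat using (ℕ; _+_; _*_; _∸_; _≤_; _<_)
open import Data.Fin using (Fin)
open import Data.List using (List)
open import Data.Product using (_×_; Σ)

open import Data.Nat using (zero; suc; z≤n)
open import Data.Nat.Properties
open import Data.Fin using (fromℕ<)
import Data.Fin.Properties as Fin
open import Data.Bool using (true)
import Data.Bool.Properties as Bool
open import Data.List using ([]; _∷_; length; map; filter; allFin)
open import Data.List.Properties using (length-map; length-tabulate; filter-notAll)
open import Data.List.Relation.Unary.All as All using (All; []; _∷_; all?)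
open import Data.List.Relation.Unary.All.Properties using (¬Any⇒All¬; ¬All⇒Any¬)
open import Data.List.Relation.Unary.Any as Any using (here; there)
open import Data.List.Relation.Unary.AllPairs using ([]; _∷_)
open import Data.List.Relation.Unary.Unique.Propositional using (Unique)
open import Data.List.Relation.Unary.Unique.Propositional.Properties using (allFin⁺; filter⁺)
open import Data.List.Relation.Binary.Subset.Propositional using (_⊆_)
open import Data.List.Membership.Propositional using (_∈_; _∉_; find)
open import Data.List.Membership.Propositional.Properties using (∈-filter⁺; ∈-filter⁻)
import Data.List.Membership.DecPropositional as DecMembership
open import Data.Product using (_,_; proj₁; proj₂; ∃)
open import Data.Sum using (inj₁; inj₂)
open import Relation.Nullary using (Dec; yes; no; ¬?; contradiction)
open import Relation.Unary using (Pred; Decidable)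
open import Level using (0ℓ)
open import Relation.Binary using (DecidableEquality)
open import Relation.Binary.PropositionalEquality using (_≡_; _≢_; refl; subst; cong; module ≡-Reasoning)

module _ {A : Set} where

  filter-nonempty : ∀ {P : Pred A 0ℓ} (P? : Decidable P) xs →
    0 < length (filter P? xs) → ∃ P
  filter-nonempty P? (x ∷ xs) h with P? x
  ... | yes px = x , px
  ... | no _   = filter-nonempty P? xs h

  filter-overlap : ∀ {P Q : Pred A 0ℓ} (P? : Decidable P) (Q? : Decidable Q) xs →
    length xs < length (filter P? xs) + length (filter Q? xs) → ∃ λ x → P x × Q x
  filter-overlap P? Q? (x ∷ xs) h with P? x | Q? x
  ... | yes px | yes qx = x , px , qx
  ... | yes _  | no _   = filter-overlap P? Q? xs (≤-pred h)
  ... | no _   | yes _  = filter-overlap P? Q? xs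
                            (≤-pred (subst (suc (length xs) <_) (+-suc _ _) h))
  ... | no _   | no _   = filter-overlap P? Q? xs (<⇒≤ h)

  module _ (_≟_ : DecidableEquality A) where
    open DecMembership _≟_ using (_∈?_)

    Unique-⊆⇒length-≤ : ∀ {xs ys : List A} → Unique xs → xs ⊆ ys → length xs ≤ length ys
    Unique-⊆⇒length-≤ {[]}     _                 _   = z≤n
    Unique-⊆⇒length-≤ {x ∷ xs} {ys} (x≢xs ∷ uxs) xs⊆ys = begin-strict
      length xs         ≤⟨ Unique-⊆⇒length-≤ uxs xs⊆ys-x ⟩
      length ys-x       <⟨ filter-notAll x≢? ys (Any.map (λ x≡y x≢y → x≢y x≡y) (xs⊆ys (here refl))) ⟩
      length ys         ∎
      where
      open ≤-Reasoning
      x≢? : Decidable (x ≢_)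
      x≢? y = ¬? (x ≟ y)
      ys-x : List A
      ys-x = filter x≢? ys
      xs⊆ys-x : xs ⊆ ys-x
      xs⊆ys-x y∈xs = ∈-filter⁺ x≢? (xs⊆ys (there y∈xs)) (All.lookup x≢xs y∈xs)

    Unique-longer⇒∃∉ : ∀ {xs ys : List A} → Unique xs → length ys < length xs →
      ∃ λ x → x ∈ xs × x ∉ ys
    Unique-longer⇒∃∉ {xs} {ys} uxs ys<xs with all? (_∈? ys) xs
    ... | yes xs⊆ys = contradiction (Unique-⊆⇒length-≤ uxs (All.lookup xs⊆ys)) (<⇒≱ ys<xs)
    ... | no xs⊈ys  = find (¬All⇒Any¬ (_∈? ys) xs xs⊈ys)

n<[n∸a]+[n∸a] : ∀ {n a} → 2 * a < n → n < (n ∸ a) + (n ∸ a)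
n<[n∸a]+[n∸a] {n} {a} 2a<n = begin-strict
  n                   ≡⟨ m∸n+n≡m a≤n ⟨
  (n ∸ a) + a         <⟨ +-monoʳ-< (n ∸ a) a<n∸a ⟩
  (n ∸ a) + (n ∸ a)   ∎
  where
  open ≤-Reasoning
  a≤n : a ≤ n
  a≤n = ≤-trans (m≤m+n a (a + 0)) (<⇒≤ 2a<n)
  a<n∸a : a < n ∸ a
  a<n∸a = +-cancelʳ-< a a (n ∸ a) (begin-strict
    a + a         ≡⟨ cong (a +_) (+-identityʳ a) ⟨
    2 * a         <⟨ 2a<n ⟩
    n             ≡⟨ m∸n+n≡m a≤n ⟨
    (n ∸ a) + a   ∎)

Connected-trans : ∀ {n₁ n₂} {G : BipGraph n₁ n₂} {x y z} →
  Connected G x y → Connected G y z → Connected G x z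
Connected-trans here         q = q
Connected-trans (step xy py) q = step xy (Connected-trans py q)

length-allFin : ∀ n → length (allFin n) ≡ n
length-allFin n = length-tabulate (λ i → i)

module _ {n₁ n₂} (G : BipGraph n₁ n₂) where

  adj? : ∀ u w → Dec (adj G u w ≡ true)
  adj? u w = adj G u w Bool.≟ true

  neighbour-of-positive-deg₁ : ∀ {u} → 0 < deg₁ G u → ∃ λ w → adj G u w ≡ true
  neighbour-of-positive-deg₁ {u} = filter-nonempty (adj? u) (allFin n₂)

  common-neighbour : ∀ {a} → (∀ w → n₁ ∸ a ≤ deg₂ G w) → 2 * a < n₁ →
    ∀ w w′ → ∃ λ u → adj G u w ≡ true × adj G u w′ ≡ true
  common-neighbour {a} deg₂≥ 2a<n₁ w w′ =
    filter-overlap (λ u → adj? u w) (λ u → adj? u w′) (allFin n₁) (begin-strict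
      length (allFin n₁)      ≡⟨ length-allFin n₁ ⟩
      n₁                      <⟨ n<[n∸a]+[n∸a] {a = a} 2a<n₁ ⟩
      (n₁ ∸ a) + (n₁ ∸ a)     ≤⟨ +-mono-≤ (deg₂≥ w) (deg₂≥ w′) ⟩
      deg₂ G w + deg₂ G w′    ∎)
    where open ≤-Reasoning

  almostComplete⇒connected : ∀ {a} → AlmostComplete a G → 2 * a < n₁ → a < n₂ →
    ∀ w₀ v → Connected G (inj₂ w₀) v
  almostComplete⇒connected {a} (deg₁≥ , deg₂≥) 2a<n₁ a<n₂ w₀ = connected
    where
    connected₂ : ∀ w → Connected G (inj₂ w₀) (inj₂ w)
    connected₂ w with common-neighbour {a} deg₂≥ 2a<n₁ w₀ w
    ... | u , w₀u , uw = step {y = inj₁ u} w₀u (step uw here)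
    connected : ∀ v → Connected G (inj₂ w₀) v
    connected (inj₂ w) = connected₂ w
    connected (inj₁ u) with neighbour-of-positive-deg₁ (<-≤-trans (m<n⇒0<n∸m a<n₂) (deg₁≥ u))
    ... | w , uw = Connected-trans (connected₂ w) (step uw here)

  extend-matching : ∀ {d M} → (∀ u → d ≤ deg₁ G u) → d ≤ n₁ →
    IsMatching G M → length M < d → ∃ λ e → IsMatching G (e ∷ M)
  extend-matching {d} {M} deg₁≥ d≤n₁ (M⊆G , uniq₁ , uniq₂) M<d
    with Unique-longer⇒∃∉ Fin._≟_ (allFin⁺ n₁) (begin-strict
           length (map proj₁ M)   ≡⟨ length-map proj₁ M ⟩
           length M               <⟨ <-≤-trans M<d d≤n₁ ⟩
           n₁                     ≡⟨ length-allFin n₁ ⟨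
           length (allFin n₁)     ∎)
    where open ≤-Reasoning
  ... | u , _ , u∉M
    with Unique-longer⇒∃∉ Fin._≟_ (filter⁺ (adj? u) (allFin⁺ n₂)) (begin-strict
           length (map proj₂ M)   ≡⟨ length-map proj₂ M ⟩
           length M               <⟨ <-≤-trans M<d (deg₁≥ u) ⟩
           deg₁ G u               ∎)
    where open ≤-Reasoning
  ... | w , w∈N[u] , w∉M =
    (u , w) , (proj₂ (∈-filter⁻ (adj? u) {xs = allFin n₂} w∈N[u]) ∷ M⊆G)
            , (¬Any⇒All¬ _ u∉M ∷ uniq₁) , (¬Any⇒All¬ _ w∉M ∷ uniq₂)

  greedy-matching : ∀ {d} → (∀ u → d ≤ deg₁ G u) → d ≤ n₁ →
    ∀ k → k ≤ d → ∃ λ M → IsMatching G M × length M ≡ k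
  greedy-matching deg₁≥ d≤n₁ zero    _   = [] , ([] , [] , []) , refl
  greedy-matching deg₁≥ d≤n₁ (suc k) k<d with greedy-matching deg₁≥ d≤n₁ k (<⇒≤ k<d)
  ... | M , M-matching , refl with extend-matching deg₁≥ d≤n₁ M-matching k<d
  ... | e , eM-matching = e ∷ M , eM-matching , refl

lemma6p13 : (n₁ n₂ : ℕ) (G : BipGraph n₁ n₂) (ℓ a : ℕ) →
    0 < ℓ → n₂ ≤ n₁ → ℓ ≤ n₂ →
    0 < a → 2 * a < ℓ →
    AlmostComplete a G →
    Σ (List (Fin n₁ × Fin n₂)) (λ M → IsConnectedMatching G M × 2 * n₂ ∸ 2 * a ≤ matchingVertices M)
lemma6p13 n₁ n₂ G ℓ a _ n₂≤n₁ ℓ≤n₂ _ 2a<ℓ ac@(deg₁≥ , _)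
  with greedy-matching G deg₁≥ (≤-trans (m∸n≤m n₂ a) n₂≤n₁) (n₂ ∸ a) ≤-refl
... | M , M-matching , |M|≡n₂∸a =
  M , (M-matching , inj₂ w₀ , All.tabulate (λ _ → connected _ , connected _)) , covers
  where
  2a<n₂ : 2 * a < n₂
  2a<n₂ = <-≤-trans 2a<ℓ ℓ≤n₂
  a<n₂ : a < n₂
  a<n₂ = ≤-<-trans (m≤m+n a (a + 0)) 2a<n₂
  w₀ : Fin n₂
  w₀ = fromℕ< a<n₂
  connected : ∀ v → Connected G (inj₂ w₀) v
  connected = almostComplete⇒connected G ac (<-≤-trans 2a<n₂ n₂≤n₁) a<n₂ w₀
  covers : 2 * n₂ ∸ 2 * a ≤ matchingVertices M
  covers = ≤-reflexive (begin
    2 * n₂ ∸ 2 * a    ≡⟨ *-distribˡ-∸ 2 n₂ a ⟨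
    2 * (n₂ ∸ a)      ≡⟨ cong (2 *_) |M|≡n₂∸a ⟨
    2 * length M      ∎)
    where open ≡-Reasoning
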